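{- Let $G$ be a connected graph with $n$ vertices and $m$ edges containing exactly one sink $s$, let $\sigma$ be a configuration with $N$ chips in total on the non-sink vertices, and let $R$ be the maximum effective resistance between $s$ and any other vertex of $G$. Then the following greedy simulation algorithm terminates (with the terminal configuration) after $O(Rm^2\log(nN))$ iterations: while some non-sink vertex is full, choose a non-sink vertex $u$ maximizing $\lfloor \sigma_u/\deg(u)\rfloor$, let $k=\lfloor\sigma_u/\deg(u)\rfloor$, set $\sigma_u\leftarrow\sigma_u-k\deg(u)$ and add $k$ chips to every non-sink neighbor of $u$. (One iteration is one execution of this loop body.)
   Context: Sandpile with a sink: $G$ is an undirected, unweighted, simple graph; $\sigma\in\mathbb{N}^{V(G)}$ gives the number of chips on each vertex. The sink $s$ never fires and chips sent to it are discarded. A non-sink vertex $v$ is full if $\sigma_v\ge\deg(v)$, where $\deg(v)$ counts all neighbors including $s$; firing $v$ decreases $\sigma_v$ by $\deg(v)$ and adds one chip to each neighbor. A configuration is terminal if no non-sink vertex is full. Effective resistance is computed in $G$ viewed as an electrical network with unit resistance on every edge. -}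

module Defs where

open import Data.Bool using (Bool; true; false; if_then_else_)
open import Data.Nat as ℕ using (ℕ; zero; suc; _∸_; _<_)
open import Data.Nat.DivMod using (_/_)
open import Data.Fin using (Fin; _≟_)
open import Data.Fin.Properties using () renaming (_≟_ to _≟F_)
open import Data.List using (List; []; _∷_; map; foldr; filter; length; allFin)
open import Data.Nat.ListAction using (sum)
open import Data.Integer using (+_)
open import Data.Rational as ℚ using (ℚ; 0ℚ; 1ℚ)
open import Data.Product using (Σ; _×_; _,_; ∃)
open import Data.Unit using (⊤)
open import Relation.Nullary using (¬_; does)
open import Relation.Binary.PropositionalEquality using (_≡_)

record Graph (n : ℕ) : Set where
  field
    adj       : Fin n → Fin n → Bool
    adj-sym   : ∀ i j → adj i j ≡ adj j i
    adj-irrefl : ∀ i → adj i i ≡ false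
open Graph public

data Reach {n : ℕ} (G : Graph n) : Fin n → Fin n → Set where
  here : ∀ {i} → Reach G i i
  step : ∀ {i j k} → adj G i j ≡ true → Reach G j k → Reach G i k

Connected : ∀ {n} → Graph n → Set
Connected G = ∀ i j → Reach G i j

-- neighbours and degree (the degree counts all neighbours, including the sink)
neighbours : ∀ {n} → Graph n → Fin n → List (Fin n)
neighbours {n} G v = filter (λ w → adj G v w ≟B true) (allFin n)
  where
  open import Data.Bool.Properties using () renaming (_≟_ to _≟B_)

deg : ∀ {n} → Graph n → Fin n → ℕ
deg G v = length (neighbours G v)

-- number of edges: each edge counted once (unordered pairs {i,j}, i < j)
numEdges : ∀ {n} → Graph n → ℕ
numEdges {n} G =
  sum (map (λ i → length (filter (λ j → Data.Fin._<?_ i j) (neighbours G i))) (allFin n))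
  where import Data.Fin

Config : ℕ → Set
Config n = Fin n → ℕ

totalChips : ∀ {n} → Fin n → Config n → ℕ
totalChips {n} s σ = sum (map σ (filter (λ v → Relation.Nullary.¬? (v ≟F s)) (allFin n)))
  where import Relation.Nullary

-- floor division, with the (irrelevant) convention a / 0 = 0
divFloor : ℕ → ℕ → ℕ
divFloor a zero = 0
divFloor a (suc d) = a / suc d

quot : ∀ {n} → Graph n → Config n → Fin n → ℕ
quot G σ v = divFloor (σ v) (deg G v)

Full : ∀ {n} → Graph n → Config n → Fin n → Set
Full G σ v = deg G v ℕ.≤ σ v

GreedyChoice : ∀ {n} → Graph n → Fin n → Config n → Fin n → Set
GreedyChoice G s σ u =
  ¬ (u ≡ s) × Full G σ u × (∀ w → ¬ (w ≡ s) → quot G σ w ℕ.≤ quot G σ u)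

greedyFire : ∀ {n} → Graph n → Fin n → Config n → Fin n → Config n
greedyFire G s σ u w with does (w ≟F u)
... | true  = σ u ∸ quot G σ u ℕ.* deg G u
... | false = if adj G u w ∧ not (does (w ≟F s))
                then σ w ℕ.+ quot G σ u
                else σ w
  where open import Data.Bool using (_∧_; not)

-- A run of the greedy algorithm from σ, recorded as the list of chosen
-- vertices; its length is the number of iterations performed.
GreedyRun : ∀ {n} → Graph n → Fin n → Config n → List (Fin n) → Set
GreedyRun G s σ [] = ⊤
GreedyRun G s σ (u ∷ us) = GreedyChoice G s σ u × GreedyRun G s (greedyFire G s σ u) us

sumℚ : ∀ {n} → (Fin n → ℚ) → ℚ
sumℚ {n} f = foldr ℚ._+_ 0ℚ (map f (allFin n))

fromℕ : ℕ → ℚ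
fromℕ k = + k ℚ./ 1

laplacian : ∀ {n} → Graph n → (Fin n → ℚ) → Fin n → ℚ
laplacian G φ w = fromℕ (deg G w) ℚ.* φ w ℚ.- sumℚ (λ x → if adj G w x then φ x else 0ℚ)

-- φ is the potential (grounded at s, φ s = 0) when a unit current enters
-- at v and leaves at s: Kirchhoff's laws (Lφ)(w) = [w = v] for all w ≠ s.
UnitPotential : ∀ {n} → Graph n → Fin n → Fin n → (Fin n → ℚ) → Set
UnitPotential G s v φ =
  φ s ≡ 0ℚ × (∀ w → ¬ (w ≡ s) → laplacian G φ w ≡ (if does (w ≟F v) then 1ℚ else 0ℚ))

-- r is the effective resistance between s and v: the voltage at v of the
-- unit-current potential (unique when G is connected).
EffRes : ∀ {n} → Graph n → Fin n → Fin n → ℚ → Set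
EffRes G s v r = Σ (_ → ℚ) λ φ → UnitPotential G s v φ × φ v ≡ r

IsMaxEffRes : ∀ {n} → Graph n → Fin n → ℚ → Set
IsMaxEffRes G s R =
  (∀ v r → ¬ (v ≡ s) → EffRes G s v r → r ℚ.≤ R) ×
  (Σ _ λ v → ¬ (v ≡ s) × EffRes G s v R)

-- A unit current injected at v and extracted at the sink has a potential φ_v that is
-- nonnegative and maximal at v, where it equals the effective resistance; so the
-- superposition h = Σ_{v ≠ s} φ_v satisfies Lh = 1 off the sink, h(s) = 0 and
-- 0 ≤ h ≤ (n − 1) R. The energy E(σ) = Σ_w σ_w h(w) therefore drops by exactly
-- k = ⌊σ_u / deg u⌋ in an iteration at u, and maximality of the greedy choice gives
-- E(σ) ≤ (k + 1) B with B = (Σ_{w ≠ s} deg w) (n − 1) R ≤ (2m)² R. While E ≥ 2^(j+1) B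
-- every iteration thus removes at least 2^j, so each of the O(log (nN)) dyadic
-- scales of E, which starts below N (n − 1) R, costs only O(B) iterations.
module Submission where

module GreedyFiring where

  open import Algebra.Bundles using (CommutativeRing)
  open import Data.Bool using (Bool; true; false; if_then_else_; not)
  import Data.Bool.Properties as Bool
  open import Data.Empty using (⊥-elim)
  open import Data.Fin as Fin using (Fin; zero; suc)
  import Data.Fin.Properties as Fin
  import Data.Integer as ℤ
  import Data.Integer.Solver
  open import Data.List as List using (List; []; _∷_; length)
  open import Data.Nat as ℕ using (ℕ; zero; suc; _^_; z≤n; s≤s)
  import Data.Nat.ListAction as ℕ
  import Data.Nat.Properties as ℕ
  open import Data.Nat.DivMod using (m/n*n≤m; m≡m%n+[m/n]*n; m%n<n; m≥n⇒m/n>0)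
  open import Data.Nat.Induction using (<-rec)
  open import Data.Nat.Logarithm using (⌈log₂_⌉; ⌈log₂⌉-mono-≤; ⌈log₂⌈n/2⌉⌉≡⌈log₂n⌉∸1)
  import Data.Nat.Solver
  open import Data.Product using (Σ; ∃; _×_; _,_; proj₁; proj₂)
  open import Data.Rational as ℚ using (ℚ; 0ℚ; 1ℚ; _+_; _*_; _-_; -_; _≤_; _<_; _<?_; 1/_; toℚᵘ; positive; nonNegative)
  open import Data.Rational.Properties
  open import Data.Rational.Solver
  import Data.Rational.Unnormalised as ℚᵘ
  import Data.Rational.Unnormalised.Properties as ℚᵘ
  open import Data.Sum using (_⊎_; inj₁; inj₂)
  open import Function using (_∘_; id)
  open import Relation.Binary.Definitions using (Tri; tri<; tri≈; tri>)
  open import Relation.Binary.PropositionalEquality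
  open import Relation.Nullary using (¬?; yes; no; does)
  open import Relation.Nullary.Decidable using (decidable-stable; dec-true; dec-false)
  open import Relation.Unary using (Pred; Decidable)
  open import Algebra.Properties.Semiring.Sum (CommutativeRing.semiring +-*-commutativeRing)
  open import Defs
  open +-*-Solver

  p≤q⇒0≤q-p : ∀ {p q} → p ≤ q → 0ℚ ≤ q - p
  p≤q⇒0≤q-p {p} {q} p≤q = subst (_≤ q - p) (+-inverseʳ p) (+-monoˡ-≤ (- p) p≤q)

  ≤-by-difference : ∀ {p q} d → q - p ≡ d → 0ℚ ≤ d → p ≤ q
  ≤-by-difference {p} {q} d q-p≡d 0≤d = subst₂ _≤_ (+-identityʳ p)
    (solve 2 (λ p q → p :+ (q :- p) := q) refl p q)
    (+-monoʳ-≤ p (subst (0ℚ ≤_) (sym q-p≡d) 0≤d))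

  -p≤0⇒0≤p : ∀ {p} → - p ≤ 0ℚ → 0ℚ ≤ p
  -p≤0⇒0≤p {p} -p≤0 = ≤-by-difference (- (- p)) (solve 1 (λ p → p :- con 0ℚ := :- (:- p)) refl p) (neg-antimono-≤ -p≤0)

  *-nonNeg : ∀ {p q} → 0ℚ ≤ p → 0ℚ ≤ q → 0ℚ ≤ p * q
  *-nonNeg {p} {q} 0≤p 0≤q =
    nonNegative⁻¹ _ {{nonNeg*nonNeg⇒nonNeg p {{nonNegative 0≤p}} q {{nonNegative 0≤q}}}}

  *-monoˡ-≤-0≤ : ∀ {p q} r → 0ℚ ≤ r → p ≤ q → r * p ≤ r * q
  *-monoˡ-≤-0≤ r 0≤r = *-monoˡ-≤-nonNeg r {{nonNegative 0≤r}}

  *-monoʳ-≤-0≤ : ∀ {p q} r → 0ℚ ≤ r → p ≤ q → p * r ≤ q * r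
  *-monoʳ-≤-0≤ r 0≤r = *-monoʳ-≤-nonNeg r {{nonNegative 0≤r}}

  0≤1 : 0ℚ ≤ 1ℚ
  0≤1 = ℚ.*≤* (ℤ.+≤+ ℕ.z≤n)

  0<1 : 0ℚ < 1ℚ
  0<1 = ℚ.*<* (ℤ.+<+ (ℕ.s≤s ℕ.z≤n))

  fromℕ-+ : ∀ a b → fromℕ (a ℕ.+ b) ≡ fromℕ a + fromℕ b
  fromℕ-+ a b = toℚᵘ-injective (ℚᵘ.≃-trans (toℚᵘ-fromℕ (a ℕ.+ b))
    (ℚᵘ.≃-trans (ℚᵘ.*≡* numerators) (ℚᵘ.≃-sym (ℚᵘ.≃-trans (toℚᵘ-homo-+ (fromℕ a) (fromℕ b))
      (ℚᵘ.+-cong (toℚᵘ-fromℕ a) (toℚᵘ-fromℕ b))))))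
    where
    open Data.Integer.Solver.+-*-Solver using () renaming (solve to solveℤ; _:+_ to _⊕_; _:*_ to _⊗_; _:=_ to _⊜_; con to κ)
    toℚᵘ-fromℕ : ∀ k → toℚᵘ (fromℕ k) ℚᵘ.≃ ℚᵘ.mkℚᵘ (ℤ.+ k) 0
    toℚᵘ-fromℕ k = toℚᵘ-fromℚᵘ (ℚᵘ.mkℚᵘ (ℤ.+ k) 0)
    numerators : (ℤ.+ a ℤ.+ ℤ.+ b) ℤ.* ℤ.1ℤ ≡ (ℤ.+ a ℤ.* ℤ.1ℤ ℤ.+ ℤ.+ b ℤ.* ℤ.1ℤ) ℤ.* ℤ.1ℤ
    numerators = solveℤ 2 (λ x y → (x ⊕ y) ⊗ κ ℤ.1ℤ ⊜ (x ⊗ κ ℤ.1ℤ ⊕ y ⊗ κ ℤ.1ℤ) ⊗ κ ℤ.1ℤ) refl (ℤ.+ a) (ℤ.+ b)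

  fromℕ-suc : ∀ k → fromℕ (suc k) ≡ 1ℚ + fromℕ k
  fromℕ-suc = fromℕ-+ 1

  fromℕ-* : ∀ a b → fromℕ (a ℕ.* b) ≡ fromℕ a * fromℕ b
  fromℕ-* zero b = sym (*-zeroˡ (fromℕ b))
  fromℕ-* (suc a) b = begin
    fromℕ (b ℕ.+ a ℕ.* b)        ≡⟨ fromℕ-+ b (a ℕ.* b) ⟩
    fromℕ b + fromℕ (a ℕ.* b)    ≡⟨ cong (fromℕ b +_) (fromℕ-* a b) ⟩
    fromℕ b + fromℕ a * fromℕ b  ≡⟨ solve 2 (λ a b → b :+ a :* b := (con 1ℚ :+ a) :* b) refl (fromℕ a) (fromℕ b) ⟩
    (1ℚ + fromℕ a) * fromℕ b     ≡⟨ cong (_* fromℕ b) (fromℕ-suc a) ⟨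
    fromℕ (suc a) * fromℕ b      ∎
    where open ≡-Reasoning

  fromℕ-∸ : ∀ {a b} → b ℕ.≤ a → fromℕ (a ℕ.∸ b) ≡ fromℕ a - fromℕ b
  fromℕ-∸ {a} {b} b≤a = begin
    fromℕ (a ℕ.∸ b)                      ≡⟨ solve 2 (λ x y → x := y :+ x :- y) refl (fromℕ (a ℕ.∸ b)) (fromℕ b) ⟩
    fromℕ b + fromℕ (a ℕ.∸ b) - fromℕ b  ≡⟨ cong (_- fromℕ b) (fromℕ-+ b (a ℕ.∸ b)) ⟨
    fromℕ (b ℕ.+ (a ℕ.∸ b)) - fromℕ b    ≡⟨ cong (λ c → fromℕ c - fromℕ b) (ℕ.m+[n∸m]≡n b≤a) ⟩
    fromℕ a - fromℕ b                    ∎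
    where open ≡-Reasoning

  0≤fromℕ : ∀ k → 0ℚ ≤ fromℕ k
  0≤fromℕ k = nonNegative⁻¹ _ {{normalize-nonNeg k 1}}

  fromℕ-mono-≤ : ∀ {a b} → a ℕ.≤ b → fromℕ a ≤ fromℕ b
  fromℕ-mono-≤ {a} {b} a≤b = ≤-by-difference (fromℕ (b ℕ.∸ a))
    (sym (fromℕ-∸ a≤b)) (0≤fromℕ (b ℕ.∸ a))

  fromℕ<fromℕ-suc : ∀ k → fromℕ k < fromℕ (suc k)
  fromℕ<fromℕ-suc k = subst₂ _<_ (+-identityˡ (fromℕ k)) (sym (fromℕ-suc k)) (+-monoˡ-< (fromℕ k) 0<1)

  fromℕ-mono-< : ∀ {a b} → a ℕ.< b → fromℕ a < fromℕ b
  fromℕ-mono-< {a} a<b = <-≤-trans (fromℕ<fromℕ-suc a) (fromℕ-mono-≤ a<b)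

  fromℕ-cancel-≤ : ∀ {a b} → fromℕ a ≤ fromℕ b → a ℕ.≤ b
  fromℕ-cancel-≤ {a} {b} fa≤fb with a ℕ.≤? b
  ... | yes a≤b = a≤b
  ... | no a≰b = ⊥-elim (<-irrefl refl (≤-<-trans (≤-trans (fromℕ-mono-≤ (ℕ.≰⇒> a≰b)) fa≤fb) (fromℕ<fromℕ-suc b)))

  -- An if rather than a pattern match, so the indicators in UnitPotential are literally 𝟙 (does …).
  𝟙 : Bool → ℚ
  𝟙 b = if b then 1ℚ else 0ℚ

  0≤𝟙 : ∀ b → 0ℚ ≤ 𝟙 b
  0≤𝟙 true = 0≤1
  0≤𝟙 false = ≤-refl

  if-else-0≡𝟙* : ∀ b x → (if b then x else 0ℚ) ≡ 𝟙 b * x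
  if-else-0≡𝟙* true x = sym (*-identityˡ x)
  if-else-0≡𝟙* false x = sym (*-zeroˡ x)

  sum-mono-≤ : ∀ {n} {f g : Fin n → ℚ} → (∀ i → f i ≤ g i) → sum f ≤ sum g
  sum-mono-≤ {zero} f≤g = ≤-refl
  sum-mono-≤ {suc n} f≤g = +-mono-≤ (f≤g zero) (sum-mono-≤ (f≤g ∘ suc))

  sum-nonNeg : ∀ {n} {f : Fin n → ℚ} → (∀ i → 0ℚ ≤ f i) → 0ℚ ≤ sum f
  sum-nonNeg {n} {f} 0≤f = subst (_≤ sum f) (sum-replicate-zero n) (sum-mono-≤ {g = f} 0≤f)

  term≤sum : ∀ {n} {f : Fin n → ℚ} → (∀ i → 0ℚ ≤ f i) → ∀ j → f j ≤ sum f
  term≤sum {suc n} {f} 0≤f j = subst₂ _≤_ (+-identityʳ (f j)) (sym (sum-remove f))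
    (+-monoʳ-≤ (f j) (sum-nonNeg (0≤f ∘ Fin.punchIn j)))

  sum-pick : ∀ {n} (v : Fin n) (f : Fin n → ℚ) → sum (λ i → 𝟙 (does (i Fin.≟ v)) * f i) ≡ f v
  sum-pick {suc n} zero f = begin
    1ℚ * f zero + sum (λ i → 0ℚ * f (suc i)) ≡⟨ cong₂ _+_ (*-identityˡ (f zero)) (sum-cong-≗ (*-zeroˡ ∘ f ∘ suc)) ⟩
    f zero + sum {n} (λ _ → 0ℚ)              ≡⟨ cong (f zero +_) (sum-replicate-zero n) ⟩
    f zero + 0ℚ                              ≡⟨ +-identityʳ (f zero) ⟩
    f zero                                   ∎
    where open ≡-Reasoning
  sum-pick {suc n} (suc v) f = begin
    0ℚ * f zero + sum (λ i → 𝟙 (does (i Fin.≟ v)) * f (suc i)) ≡⟨ cong₂ _+_ (*-zeroˡ (f zero)) (sum-pick v (f ∘ suc)) ⟩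
    0ℚ + f (suc v)                                             ≡⟨ +-identityˡ (f (suc v)) ⟩
    f (suc v)                                                  ∎
    where open ≡-Reasoning

  ∑-distrib-- : ∀ {n} (f g : Fin n → ℚ) → sum (λ i → f i - g i) ≡ sum f - sum g
  ∑-distrib-- f g = begin
    sum (λ i → f i - g i)              ≡⟨ ∑-distrib-+ f (λ i → - g i) ⟩
    sum f + sum (λ i → - g i)          ≡⟨ cong (sum f +_) (sum-cong-≗ (λ i → neg≡-1* (g i))) ⟩
    sum f + sum (λ i → - 1ℚ * g i)     ≡⟨ cong (sum f +_) (*-distribˡ-sum (- 1ℚ) g) ⟨
    sum f + - 1ℚ * sum g               ≡⟨ cong (sum f +_) (neg≡-1* (sum g)) ⟨
    sum f - sum g                      ∎
    where
    open ≡-Reasoning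
    neg≡-1* : ∀ x → - x ≡ - 1ℚ * x
    neg≡-1* x = solve 1 (λ x → :- x := con (- 1ℚ) :* x) refl x

  ∑ᴸ : {A : Set} → List A → (A → ℚ) → ℚ
  ∑ᴸ xs f = List.foldr _+_ 0ℚ (List.map f xs)

  ∑ᴸ-tabulate : ∀ {A : Set} {n} (g : Fin n → A) (f : A → ℚ) → ∑ᴸ (List.tabulate g) f ≡ sum (f ∘ g)
  ∑ᴸ-tabulate {n = zero} g f = refl
  ∑ᴸ-tabulate {n = suc n} g f = cong (f (g zero) +_) (∑ᴸ-tabulate (g ∘ suc) f)

  ∑ᴸ-filter : ∀ {A : Set} {ℓ} {P : Pred A ℓ} (P? : Decidable P) (xs : List A) (f : A → ℚ) →
              ∑ᴸ (List.filter P? xs) f ≡ ∑ᴸ xs (λ x → if does (P? x) then f x else 0ℚ)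
  ∑ᴸ-filter P? [] f = refl
  ∑ᴸ-filter P? (x ∷ xs) f with does (P? x)
  ... | true = cong (f x +_) (∑ᴸ-filter P? xs f)
  ... | false = trans (∑ᴸ-filter P? xs f) (sym (+-identityˡ _))

  fromℕ-length : ∀ {A : Set} (xs : List A) → fromℕ (length xs) ≡ ∑ᴸ xs (λ _ → 1ℚ)
  fromℕ-length [] = refl
  fromℕ-length (x ∷ xs) = trans (fromℕ-suc (length xs)) (cong (1ℚ +_) (fromℕ-length xs))

  fromℕ-sum : ∀ {A : Set} (xs : List A) (g : A → ℕ) → fromℕ (ℕ.sum (List.map g xs)) ≡ ∑ᴸ xs (fromℕ ∘ g)
  fromℕ-sum [] g = refl
  fromℕ-sum (x ∷ xs) g = trans (fromℕ-+ (g x) _) (cong (fromℕ (g x) +_) (fromℕ-sum xs g))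

  -- Square linear systems

  Matrix : ℕ → Set
  Matrix n = Fin n → Fin n → ℚ

  infixl 7 _·_
  _·_ : ∀ {n} → Matrix n → (Fin n → ℚ) → Fin n → ℚ
  (A · x) i = sum (λ j → A i j * x j)

  TrivialKernel : ∀ {n} → Matrix n → Set
  TrivialKernel A = ∀ x → (∀ i → (A · x) i ≡ 0ℚ) → ∀ j → x j ≡ 0ℚ

  Solution : ∀ {n} → Matrix n → (Fin n → ℚ) → Set
  Solution A b = Σ (_ → ℚ) λ x → ∀ i → (A · x) i ≡ b i

  ≡-or-punchIn : ∀ {n} (r i : Fin (suc n)) → i ≡ r ⊎ ∃ λ i′ → Fin.punchIn r i′ ≡ i
  ≡-or-punchIn r i with i Fin.≟ r
  ... | yes i≡r = inj₁ i≡r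
  ... | no i≢r = inj₂ (Fin.punchOut (i≢r ∘ sym) , Fin.punchIn-punchOut (i≢r ∘ sym))

  module Elimination {n} (A : Matrix (suc n)) (r : Fin (suc n)) (A-r0≢0 : A r zero ≢ 0ℚ) where

    private instance
      pivot≢0 : ℚ.NonZero (A r zero)
      pivot≢0 = ℚ.≢-nonZero A-r0≢0

    pivot⁻¹ : ℚ
    pivot⁻¹ = 1/ (A r zero)

    multiplier : Fin (suc n) → ℚ
    multiplier i = A i zero * pivot⁻¹

    A′ : Matrix n
    A′ i j = A (Fin.punchIn r i) (suc j) - multiplier (Fin.punchIn r i) * A r (suc j)

    rest : (Fin n → ℚ) → ℚ
    rest y = sum (λ j → A r (suc j) * y j)

    backSubstitute : ℚ → (Fin n → ℚ) → Fin (suc n) → ℚ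
    backSubstitute β y zero = pivot⁻¹ * (β - rest y)
    backSubstitute β y (suc j) = y j

    pivot-row : ∀ β y → (A · backSubstitute β y) r ≡ β
    pivot-row β y = begin
      p * (pivot⁻¹ * (β - rest y)) + rest y  ≡⟨ solve 4 (λ a b x t → a :* (b :* (x :- t)) :+ t := (a :* b) :* (x :- t) :+ t) refl p pivot⁻¹ β (rest y) ⟩
      p * pivot⁻¹ * (β - rest y) + rest y    ≡⟨ cong (λ z → z * (β - rest y) + rest y) (*-inverseʳ p) ⟩
      1ℚ * (β - rest y) + rest y             ≡⟨ solve 2 (λ x t → con 1ℚ :* (x :- t) :+ t := x) refl β (rest y) ⟩
      β                                      ∎
      where
      open ≡-Reasoning
      p : ℚ
      p = A r zero

    other-row : ∀ β y i → (A · backSubstitute β y) (Fin.punchIn r i) ≡ (A′ · y) i + multiplier (Fin.punchIn r i) * β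
    other-row β y i = begin
      a * (pivot⁻¹ * (β - rest y)) + row       ≡⟨ rearrange a pivot⁻¹ β (rest y) row ⟩
      (row - c * rest y) + c * β               ≡⟨ cong (_+ c * β) reduced-row ⟨
      (A′ · y) i + c * β                       ∎
      where
      open ≡-Reasoning
      a : ℚ
      a = A (Fin.punchIn r i) zero
      c = multiplier (Fin.punchIn r i)
      row = sum (λ j → A (Fin.punchIn r i) (suc j) * y j)
      rearrange : ∀ a b x t u → a * (b * (x - t)) + u ≡ (u - a * b * t) + a * b * x
      rearrange = solve 5 (λ a b x t u → a :* (b :* (x :- t)) :+ u := (u :- a :* b :* t) :+ a :* b :* x) refl
      reduced-row : (A′ · y) i ≡ row - c * rest y
      reduced-row = begin
        sum (λ j → (A (Fin.punchIn r i) (suc j) - c * A r (suc j)) * y j)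
          ≡⟨ sum-cong-≗ (λ j → solve 4 (λ u k w z → (u :- k :* w) :* z := u :* z :- k :* (w :* z)) refl (A (Fin.punchIn r i) (suc j)) c (A r (suc j)) (y j)) ⟩
        sum (λ j → A (Fin.punchIn r i) (suc j) * y j - c * (A r (suc j) * y j))
          ≡⟨ ∑-distrib-- (λ j → A (Fin.punchIn r i) (suc j) * y j) (λ j → c * (A r (suc j) * y j)) ⟩
        row - sum (λ j → c * (A r (suc j) * y j))
          ≡⟨ cong (λ z → row - z) (*-distribˡ-sum c (λ j → A r (suc j) * y j)) ⟨
        row - c * rest y ∎

    A′-trivialKernel : TrivialKernel A → TrivialKernel A′
    A′-trivialKernel ker y A′y≡0 j = ker (backSubstitute 0ℚ y) Ax≡0 (suc j)
      where
      Ax≡0 : ∀ i → (A · backSubstitute 0ℚ y) i ≡ 0ℚ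
      Ax≡0 i with ≡-or-punchIn r i
      ... | inj₁ refl = pivot-row 0ℚ y
      ... | inj₂ (i′ , refl) = begin
        (A · backSubstitute 0ℚ y) (Fin.punchIn r i′)  ≡⟨ other-row 0ℚ y i′ ⟩
        (A′ · y) i′ + multiplier (Fin.punchIn r i′) * 0ℚ ≡⟨ cong₂ _+_ (A′y≡0 i′) (*-zeroʳ (multiplier (Fin.punchIn r i′))) ⟩
        0ℚ + 0ℚ                                        ≡⟨ +-identityʳ 0ℚ ⟩
        0ℚ                                             ∎
        where open ≡-Reasoning

    lift-solution : ∀ b → Solution A′ (λ i → b (Fin.punchIn r i) - multiplier (Fin.punchIn r i) * b r) → Solution A b
    lift-solution b (y , A′y≡b′) = backSubstitute (b r) y , Ax≡b
      where
      Ax≡b : ∀ i → (A · backSubstitute (b r) y) i ≡ b i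
      Ax≡b i with ≡-or-punchIn r i
      ... | inj₁ refl = pivot-row (b r) y
      ... | inj₂ (i′ , refl) = trans (other-row (b r) y i′) (trans (cong (_+ c * b r) (A′y≡b′ i′))
             (solve 2 (λ u v → u :- v :+ v := u) refl (b (Fin.punchIn r i′)) (c * b r)))
        where
        c : ℚ
        c = multiplier (Fin.punchIn r i′)

  trivialKernel⇒solvable : ∀ {n} (A : Matrix n) → TrivialKernel A → ∀ b → Solution A b
  trivialKernel⇒solvable {zero} A ker b = (λ ()) , (λ ())
  trivialKernel⇒solvable {suc n} A ker b with Fin.any? (λ i → ¬? (A i zero ≟ 0ℚ))
  ... | yes (r , A-r0≢0) = lift-solution b (trivialKernel⇒solvable A′ (A′-trivialKernel ker) _)
    where open Elimination A r A-r0≢0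
  ... | no no-pivot = ⊥-elim (1≢0 (ker e₀ Ae₀≡0 zero))
    where
    e₀ : Fin (suc n) → ℚ
    e₀ zero = 1ℚ
    e₀ (suc j) = 0ℚ
    Ae₀≡0 : ∀ i → (A · e₀) i ≡ 0ℚ
    Ae₀≡0 i = begin
      A i zero * 1ℚ + sum (λ j → A i (suc j) * 0ℚ) ≡⟨ cong₂ _+_ (*-identityʳ (A i zero)) (sum-cong-≗ (λ j → *-zeroʳ (A i (suc j)))) ⟩
      A i zero + sum {n} (λ _ → 0ℚ)               ≡⟨ cong₂ _+_ (decidable-stable (A i zero ≟ 0ℚ) (λ ne → no-pivot (i , ne))) (sum-replicate-zero n) ⟩
      0ℚ + 0ℚ                                     ≡⟨ +-identityʳ 0ℚ ⟩
      0ℚ                                          ∎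
      where open ≡-Reasoning

  -- The graph Laplacian and the maximum principle

  does-≟-sym : ∀ {n} (u v : Fin n) → does (u Fin.≟ v) ≡ does (v Fin.≟ u)
  does-≟-sym u v with u Fin.≟ v | v Fin.≟ u
  ... | yes _   | yes _   = refl
  ... | no _    | no _    = refl
  ... | yes u≡v | no v≢u  = ⊥-elim (v≢u (sym u≡v))
  ... | no u≢v  | yes v≡u = ⊥-elim (u≢v (sym v≡u))

  ≟-cases : ∀ {n} {P : Set} (w s : Fin n) → (w ≡ s → P) → (w ≢ s → P) → P
  ≟-cases w s on-≡ on-≢ with w Fin.≟ s
  ... | yes w≡s = on-≡ w≡s
  ... | no w≢s = on-≢ w≢s

  argmax : ∀ {n} → Fin n → (f : Fin n → ℚ) → ∃ λ u → ∀ y → f y ≤ f u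
  argmax {suc zero} _ f = zero , λ { zero → ≤-refl }
  argmax {suc (suc n)} _ f with argmax zero (f ∘ suc)
  ... | u , f∘suc≤fu with ≤-total (f zero) (f (suc u))
  ... | inj₁ f0≤fu = suc u , λ { zero → f0≤fu ; (suc y) → f∘suc≤fu y }
  ... | inj₂ fu≤f0 = zero , λ { zero → ≤-refl ; (suc y) → ≤-trans (f∘suc≤fu y) fu≤f0 }

  module _ {n} (G : Graph n) where

    fromℕ-deg : ∀ v → fromℕ (deg G v) ≡ sum (λ w → 𝟙 (adj G v w))
    fromℕ-deg v = begin
      fromℕ (deg G v)                                                     ≡⟨ fromℕ-length (neighbours G v) ⟩
      ∑ᴸ (neighbours G v) (λ _ → 1ℚ)                                      ≡⟨ ∑ᴸ-filter (λ w → adj G v w Bool.≟ true) (List.allFin n) (λ _ → 1ℚ) ⟩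
      ∑ᴸ (List.allFin n) (λ w → 𝟙 (does (adj G v w Bool.≟ true)))        ≡⟨ ∑ᴸ-tabulate id (λ w → 𝟙 (does (adj G v w Bool.≟ true))) ⟩
      sum (λ w → 𝟙 (does (adj G v w Bool.≟ true)))                        ≡⟨ sum-cong-≗ (λ w → cong 𝟙 (does-≟true (adj G v w))) ⟩
      sum (λ w → 𝟙 (adj G v w))                                           ∎
      where
      open ≡-Reasoning
      does-≟true : ∀ b → does (b Bool.≟ true) ≡ b
      does-≟true true = refl
      does-≟true false = refl

    laplacian≡deg*-∑ : ∀ φ w → laplacian G φ w ≡ fromℕ (deg G w) * φ w - sum (λ z → 𝟙 (adj G w z) * φ z)
    laplacian≡deg*-∑ φ w = cong (λ z → fromℕ (deg G w) * φ w - z)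
      (trans (∑ᴸ-tabulate id (λ z → if adj G w z then φ z else 0ℚ)) (sum-cong-≗ (λ z → if-else-0≡𝟙* (adj G w z) (φ z))))

    laplacian≡∑differences : ∀ φ w → laplacian G φ w ≡ sum (λ z → 𝟙 (adj G w z) * (φ w - φ z))
    laplacian≡∑differences φ w = begin
      laplacian G φ w                                            ≡⟨ laplacian≡deg*-∑ φ w ⟩
      fromℕ (deg G w) * φ w - sum (λ z → a z * φ z)              ≡⟨ cong (λ d → d * φ w - sum (λ z → a z * φ z)) (fromℕ-deg w) ⟩
      sum a * φ w - sum (λ z → a z * φ z)                        ≡⟨ cong (_- sum (λ z → a z * φ z)) (*-distribʳ-sum (φ w) a) ⟩
      sum (λ z → a z * φ w) - sum (λ z → a z * φ z)              ≡⟨ ∑-distrib-- (λ z → a z * φ w) (λ z → a z * φ z) ⟨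
      sum (λ z → a z * φ w - a z * φ z)                          ≡⟨ sum-cong-≗ (λ z → factor (a z) (φ w) (φ z)) ⟩
      sum (λ z → a z * (φ w - φ z))                              ∎
      where
      open ≡-Reasoning
      a : Fin n → ℚ
      a = λ z → 𝟙 (adj G w z)
      factor : ∀ a x y → a * x - a * y ≡ a * (x - y)
      factor = solve 3 (λ a x y → a :* x :- a :* y := a :* (x :- y)) refl

    laplacian-neg : ∀ φ w → laplacian G (λ z → - φ z) w ≡ - laplacian G φ w
    laplacian-neg φ w = begin
      laplacian G (λ z → - φ z) w                          ≡⟨ laplacian≡∑differences _ w ⟩
      sum (λ z → 𝟙 (adj G w z) * (- φ w - - φ z))          ≡⟨ sum-cong-≗ (λ z → negate (𝟙 (adj G w z)) (φ w) (φ z)) ⟩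
      sum (λ z → - 1ℚ * (𝟙 (adj G w z) * (φ w - φ z)))     ≡⟨ *-distribˡ-sum (- 1ℚ) (λ z → 𝟙 (adj G w z) * (φ w - φ z)) ⟨
      - 1ℚ * sum (λ z → 𝟙 (adj G w z) * (φ w - φ z))       ≡⟨ cong (- 1ℚ *_) (laplacian≡∑differences φ w) ⟨
      - 1ℚ * laplacian G φ w                               ≡⟨ solve 1 (λ x → con (- 1ℚ) :* x := :- x) refl (laplacian G φ w) ⟩
      - laplacian G φ w                                    ∎
      where
      open ≡-Reasoning
      negate : ∀ a x y → a * (- x - - y) ≡ - 1ℚ * (a * (x - y))
      negate = solve 3 (λ a x y → a :* (:- x :- :- y) := con (- 1ℚ) :* (a :* (x :- y))) refl

    laplacian-∑-scaled : ∀ {m} (c : Fin m → ℚ) (g : Fin m → Fin n → ℚ) w →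
                         laplacian G (λ z → sum (λ v → c v * g v z)) w ≡ sum (λ v → c v * laplacian G (g v) w)
    laplacian-∑-scaled {m} c g w = begin
      laplacian G (λ z → sum (λ v → c v * g v z)) w
        ≡⟨ laplacian≡∑differences _ w ⟩
      sum (λ z → 𝟙 (adj G w z) * (sum (λ v → c v * g v w) - sum (λ v → c v * g v z)))
        ≡⟨ sum-cong-≗ (λ z → cong (𝟙 (adj G w z) *_) (∑-distrib-- (λ v → c v * g v w) (λ v → c v * g v z))) ⟨
      sum (λ z → 𝟙 (adj G w z) * sum (λ v → c v * g v w - c v * g v z))
        ≡⟨ sum-cong-≗ (λ z → *-distribˡ-sum (𝟙 (adj G w z)) (λ v → c v * g v w - c v * g v z)) ⟩
      sum (λ z → sum (λ v → 𝟙 (adj G w z) * (c v * g v w - c v * g v z)))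
        ≡⟨ ∑-comm (λ z v → 𝟙 (adj G w z) * (c v * g v w - c v * g v z)) ⟩
      sum (λ v → sum (λ z → 𝟙 (adj G w z) * (c v * g v w - c v * g v z)))
        ≡⟨ sum-cong-≗ (λ v → sum-cong-≗ (λ z → commute (𝟙 (adj G w z)) (c v) (g v w) (g v z))) ⟩
      sum (λ v → sum (λ z → c v * (𝟙 (adj G w z) * (g v w - g v z))))
        ≡⟨ sum-cong-≗ (λ v → *-distribˡ-sum (c v) (λ z → 𝟙 (adj G w z) * (g v w - g v z))) ⟨
      sum (λ v → c v * sum (λ z → 𝟙 (adj G w z) * (g v w - g v z)))
        ≡⟨ sum-cong-≗ (λ v → cong (c v *_) (laplacian≡∑differences (g v) w)) ⟨
      sum (λ v → c v * laplacian G (g v) w) ∎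
      where
      open ≡-Reasoning
      commute : ∀ a c x y → a * (c * x - c * y) ≡ c * (a * (x - y))
      commute = solve 4 (λ a c x y → a :* (c :* x :- c :* y) := c :* (a :* (x :- y))) refl

    1≤deg : Connected G → ∀ {s} w → w ≢ s → 1 ℕ.≤ deg G w
    1≤deg conn {s} w w≢s with conn w s
    ... | here = ⊥-elim (w≢s refl)
    ... | step {j = v} w~v _ = fromℕ-cancel-≤ (subst (_≤ fromℕ (deg G w)) (cong 𝟙 w~v)
            (subst (𝟙 (adj G w v) ≤_) (sym (fromℕ-deg w)) (term≤sum (λ z → 0≤𝟙 (adj G w z)) v)))

    -- At a maximum u every term of laplacian≡∑differences is nonnegative, so Lx(u) ≤ 0 bounds each by 0.
    maximum-spreads : ∀ x u → (∀ y → x y ≤ x u) → laplacian G x u ≤ 0ℚ → ∀ v → adj G u v ≡ true → x u ≤ x v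
    maximum-spreads x u x≤xu Lxu≤0 v u~v = ≤-by-difference (- term v) xv-xu≡-term (neg-antimono-≤ term-v≤0)
      where
      term : Fin n → ℚ
      term z = 𝟙 (adj G u z) * (x u - x z)
      term-v≤0 : term v ≤ 0ℚ
      term-v≤0 = ≤-trans (term≤sum (λ z → *-nonNeg (0≤𝟙 (adj G u z)) (p≤q⇒0≤q-p (x≤xu z))) v)
                         (subst (_≤ 0ℚ) (laplacian≡∑differences x u) Lxu≤0)
      xv-xu≡-term : x v - x u ≡ - term v
      xv-xu≡-term = trans (solve 2 (λ p q → q :- p := :- (con 1ℚ :* (p :- q))) refl (x u) (x v))
        (cong (λ b → - (𝟙 b * (x u - x v))) (sym u~v))

    maximum-principle : Connected G → ∀ x t → (∀ w → w ≢ t → (∀ y → x y ≤ x w) → laplacian G x w ≤ 0ℚ) →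
                        ∀ w → x w ≤ x t
    maximum-principle conn x t subharmonic = walk (proj₁ max) (proj₂ max) (conn (proj₁ max) t)
      where
      max : ∃ λ u → ∀ y → x y ≤ x u
      max = argmax t x
      walk : ∀ u → (∀ y → x y ≤ x u) → Reach G u t → ∀ y → x y ≤ x t
      walk u x≤xu here = x≤xu
      walk u x≤xu (step {j = v} u~v v⇝t) = ≟-cases u t (λ { refl → x≤xu })
        (λ u≢t → walk v (λ y → ≤-trans (x≤xu y) (maximum-spreads x u x≤xu (subharmonic u u≢t x≤xu) v u~v)) v⇝t)

  -- Unit potentials

  module _ {n} {G : Graph n} (conn : Connected G) {s v : Fin n} {φ : Fin n → ℚ} (φ-unit : UnitPotential G s v φ) where

    private
      φs≡0 : φ s ≡ 0ℚ
      φs≡0 = proj₁ φ-unit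
      Lφ≡𝟙 : ∀ w → w ≢ s → laplacian G φ w ≡ 𝟙 (does (w Fin.≟ v))
      Lφ≡𝟙 = proj₂ φ-unit

    unitPotential-nonNeg : ∀ w → 0ℚ ≤ φ w
    unitPotential-nonNeg w = -p≤0⇒0≤p (subst (- φ w ≤_) (cong -_ φs≡0)
      (maximum-principle G conn (λ z → - φ z) s -φ-subharmonic w))
      where
      -φ-subharmonic : ∀ w → w ≢ s → (∀ y → - φ y ≤ - φ w) → laplacian G (λ z → - φ z) w ≤ 0ℚ
      -φ-subharmonic w w≢s _ = subst (_≤ 0ℚ) (sym (trans (laplacian-neg G φ w) (cong -_ (Lφ≡𝟙 w w≢s))))
        (neg-antimono-≤ (0≤𝟙 (does (w Fin.≟ v))))

    laplacian-sink≤0 : laplacian G φ s ≤ 0ℚ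
    laplacian-sink≤0 = subst (_≤ 0ℚ) (sym (laplacian≡∑differences G φ s))
      (subst (sum (λ z → 𝟙 (adj G s z) * (φ s - φ z)) ≤_) (sum-replicate-zero n) (sum-mono-≤ term≤0))
      where
      term≤0 : ∀ z → 𝟙 (adj G s z) * (φ s - φ z) ≤ 0ℚ
      term≤0 z = subst (𝟙 (adj G s z) * (φ s - φ z) ≤_) (*-zeroʳ (𝟙 (adj G s z)))
        (*-monoˡ-≤-0≤ (𝟙 (adj G s z)) (0≤𝟙 (adj G s z)) φs-φz≤0)
        where
        φs-φz≤0 : φ s - φ z ≤ 0ℚ
        φs-φz≤0 = ≤-by-difference (φ z - φ s) (solve 2 (λ p q → con 0ℚ :- (p :- q) := q :- p) refl (φ s) (φ z))
          (p≤q⇒0≤q-p (subst (_≤ φ z) (sym φs≡0) (unitPotential-nonNeg z)))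

    unitPotential-≤-source : ∀ w → φ w ≤ φ v
    unitPotential-≤-source = maximum-principle G conn φ v subharmonic
      where
      subharmonic : ∀ w → w ≢ v → (∀ y → φ y ≤ φ w) → laplacian G φ w ≤ 0ℚ
      subharmonic w w≢v _ = ≟-cases w s (λ { refl → laplacian-sink≤0 })
        (λ w≢s → ≤-reflexive (trans (Lφ≡𝟙 w w≢s) (cong 𝟙 (dec-false (w Fin.≟ v) w≢v))))

  module _ {n} (G : Graph (suc n)) (conn : Connected G) (s : Fin (suc n)) where

    private
      ι : Fin n → Fin (suc n)
      ι = Fin.punchIn s

    grounded : (Fin n → ℚ) → Fin (suc n) → ℚ
    grounded y w with w Fin.≟ s
    ... | yes _ = 0ℚ
    ... | no w≢s = y (Fin.punchOut (w≢s ∘ sym))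

    grounded-sink : ∀ y → grounded y s ≡ 0ℚ
    grounded-sink y with s Fin.≟ s
    ... | yes _ = refl
    ... | no s≢s = ⊥-elim (s≢s refl)

    grounded-punchIn : ∀ y i → grounded y (ι i) ≡ y i
    grounded-punchIn y i with ι i Fin.≟ s
    ... | yes ιi≡s = ⊥-elim (Fin.punchInᵢ≢i s i ιi≡s)
    ... | no ιi≢s = cong y (trans (Fin.punchOut-cong s {i≢k = Fin.punchInᵢ≢i s i ∘ sym} refl) (Fin.punchOut-punchIn s))

    nonSink-elim : (P : Fin (suc n) → Set) → (∀ i → P (ι i)) → ∀ w → w ≢ s → P w
    nonSink-elim P P-ι w w≢s with ≡-or-punchIn s w
    ... | inj₁ w≡s = ⊥-elim (w≢s w≡s)
    ... | inj₂ (i , refl) = P-ι i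

    reducedLaplacian : Matrix n
    reducedLaplacian i j = 𝟙 (does (j Fin.≟ i)) * fromℕ (deg G (ι i)) - 𝟙 (adj G (ι i) (ι j))

    laplacian-grounded : ∀ y i → laplacian G (grounded y) (ι i) ≡ (reducedLaplacian · y) i
    laplacian-grounded y i = begin
      laplacian G (grounded y) (ι i)
        ≡⟨ laplacian≡deg*-∑ G (grounded y) (ι i) ⟩
      d * grounded y (ι i) - sum (λ z → a z * grounded y z)
        ≡⟨ cong₂ (λ x t → d * x - t) (grounded-punchIn y i) (sum-remove (λ z → a z * grounded y z)) ⟩
      d * y i - (a s * grounded y s + sum (λ j → a (ι j) * grounded y (ι j)))
        ≡⟨ cong₂ (λ x t → d * y i - (a s * x + t)) (grounded-sink y) (sum-cong-≗ (λ j → cong (a (ι j) *_) (grounded-punchIn y j))) ⟩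
      d * y i - (a s * 0ℚ + W)
        ≡⟨ solve 4 (λ d y a w → d :* y :- (a :* con 0ℚ :+ w) := d :* y :- w) refl d (y i) (a s) W ⟩
      d * y i - W
        ≡⟨ cong (_- W) (sum-pick i (λ j → d * y j)) ⟨
      sum (λ j → 𝟙 (does (j Fin.≟ i)) * (d * y j)) - W
        ≡⟨ ∑-distrib-- (λ j → 𝟙 (does (j Fin.≟ i)) * (d * y j)) (λ j → a (ι j) * y j) ⟨
      sum (λ j → 𝟙 (does (j Fin.≟ i)) * (d * y j) - a (ι j) * y j)
        ≡⟨ sum-cong-≗ (λ j → solve 4 (λ e d a y → e :* (d :* y) :- a :* y := (e :* d :- a) :* y) refl (𝟙 (does (j Fin.≟ i))) d (a (ι j)) (y j)) ⟩
      (reducedLaplacian · y) i ∎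
      where
      open ≡-Reasoning
      d : ℚ
      d = fromℕ (deg G (ι i))
      a : Fin (suc n) → ℚ
      a = λ z → 𝟙 (adj G (ι i) z)
      W : ℚ
      W = sum (λ j → a (ι j) * y j)

    reducedLaplacian-trivialKernel : TrivialKernel reducedLaplacian
    reducedLaplacian-trivialKernel y Ly≡0 j = trans (sym (grounded-punchIn y j)) (≤-antisym x≤0 0≤x)
      where
      x : Fin (suc n) → ℚ
      x = grounded y
      harmonic : ∀ w → w ≢ s → laplacian G x w ≡ 0ℚ
      harmonic = nonSink-elim (λ w → laplacian G x w ≡ 0ℚ) (λ i → trans (laplacian-grounded y i) (Ly≡0 i))
      x≤0 : x (ι j) ≤ 0ℚ
      x≤0 = subst (x (ι j) ≤_) (grounded-sink y)
        (maximum-principle G conn x s (λ w w≢s _ → ≤-reflexive (harmonic w w≢s)) (ι j))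
      0≤x : 0ℚ ≤ x (ι j)
      0≤x = -p≤0⇒0≤p (subst (- x (ι j) ≤_) (cong -_ (grounded-sink y))
        (maximum-principle G conn (λ z → - x z) s
          (λ w w≢s _ → ≤-reflexive (trans (laplacian-neg G x w) (cong -_ (harmonic w w≢s)))) (ι j)))

    -- Abstract, since unfolding the Gaussian elimination makes type checking blow up.
    abstract
      reducedSolution : ∀ v → Solution reducedLaplacian (λ i → 𝟙 (does (ι i Fin.≟ v)))
      reducedSolution v = trivialKernel⇒solvable reducedLaplacian reducedLaplacian-trivialKernel _

    unitPotential : ∀ v → ∃ (UnitPotential G s v)
    unitPotential v = grounded y , grounded-sink y , Lx≡𝟙
      where
      y : Fin n → ℚ
      y = proj₁ (reducedSolution v)
      Lx≡𝟙 : ∀ w → w ≢ s → laplacian G (grounded y) w ≡ 𝟙 (does (w Fin.≟ v))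
      Lx≡𝟙 = nonSink-elim (λ w → laplacian G (grounded y) w ≡ 𝟙 (does (w Fin.≟ v)))
        (λ i → trans (laplacian-grounded y i) (proj₂ (reducedSolution v) i))

  -- The load potential

  isNonSink : ∀ {n} → Fin n → Fin n → Bool
  isNonSink s v = not (does (v Fin.≟ s))

  𝟙-isNonSink : ∀ {n} {s v : Fin n} → v ≢ s → 𝟙 (isNonSink s v) ≡ 1ℚ
  𝟙-isNonSink {s = s} {v} v≢s with v Fin.≟ s
  ... | yes v≡s = ⊥-elim (v≢s v≡s)
  ... | no _ = refl

  nonSinkSum : ∀ {n} → Fin n → (Fin n → ℚ) → ℚ
  nonSinkSum s f = sum (λ w → 𝟙 (isNonSink s w) * f w)

  𝟙-isNonSink-mono-≤ : ∀ {n} {s w : Fin n} {x y} → (w ≢ s → x ≤ y) → 𝟙 (isNonSink s w) * x ≤ 𝟙 (isNonSink s w) * y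
  𝟙-isNonSink-mono-≤ {s = s} {w} {x} {y} x≤y with w Fin.≟ s
  ... | yes _ = ≤-reflexive (trans (*-zeroˡ x) (sym (*-zeroˡ y)))
  ... | no w≢s = *-monoˡ-≤-0≤ 1ℚ 0≤1 (x≤y w≢s)

  nonSinkSum-mono-≤ : ∀ {n} (s : Fin n) {f g : Fin n → ℚ} → (∀ w → w ≢ s → f w ≤ g w) → nonSinkSum s f ≤ nonSinkSum s g
  nonSinkSum-mono-≤ s f≤g = sum-mono-≤ (λ w → 𝟙-isNonSink-mono-≤ (f≤g w))

  nonSinkSum-*ˡ : ∀ {n} (s : Fin n) c (f : Fin n → ℚ) → nonSinkSum s (λ w → c * f w) ≡ c * nonSinkSum s f
  nonSinkSum-*ˡ s c f = trans (sum-cong-≗ (λ w → swap (𝟙 (isNonSink s w)) c (f w)))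
    (sym (*-distribˡ-sum c (λ w → 𝟙 (isNonSink s w) * f w)))
    where
    swap : ∀ a c x → a * (c * x) ≡ c * (a * x)
    swap = solve 3 (λ a c x → a :* (c :* x) := c :* (a :* x)) refl

  nonSinkSum-≤-sum : ∀ {n} (s : Fin n) {f : Fin n → ℚ} → (∀ w → 0ℚ ≤ f w) → nonSinkSum s f ≤ sum f
  nonSinkSum-≤-sum s {f} 0≤f = sum-mono-≤ 𝟙*f≤f
    where
    𝟙*f≤f : ∀ w → 𝟙 (isNonSink s w) * f w ≤ f w
    𝟙*f≤f w with w Fin.≟ s
    ... | yes _ = subst (_≤ f w) (sym (*-zeroˡ (f w))) (0≤f w)
    ... | no _ = ≤-reflexive (*-identityˡ (f w))

  ≤-nonSinkSum : ∀ {n} (s : Fin n) {f : Fin n → ℚ} → (∀ w → 0ℚ ≤ f w) → ∀ {v} → v ≢ s → f v ≤ nonSinkSum s f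
  ≤-nonSinkSum s {f} 0≤f {v} v≢s = subst (_≤ nonSinkSum s f) (trans (cong (_* f v) (𝟙-isNonSink v≢s)) (*-identityˡ (f v)))
    (term≤sum (λ w → *-nonNeg (0≤𝟙 (isNonSink s w)) (0≤f w)) v)

  record LoadPotential {n} (G : Graph n) (s : Fin n) (H : ℚ) : Set where
    field
      h : Fin n → ℚ
      h-sink : h s ≡ 0ℚ
      h-nonNeg : ∀ w → 0ℚ ≤ h w
      h-≤ : ∀ w → h w ≤ H
      laplacian-h : ∀ u → u ≢ s → laplacian G h u ≡ 1ℚ

  maxEffRes-nonNeg : ∀ {n} {G : Graph n} {s R} → Connected G → IsMaxEffRes G s R → 0ℚ ≤ R
  maxEffRes-nonNeg conn (_ , v , _ , φ , φ-unit , φv≡R) = subst (0ℚ ≤_) φv≡R (unitPotential-nonNeg conn φ-unit v)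

  module _ {n} {G : Graph (suc n)} (conn : Connected G) {s : Fin (suc n)} {R : ℚ} (R-max : IsMaxEffRes G s R) where

    private
      φ : Fin (suc n) → Fin (suc n) → ℚ
      φ v = proj₁ (unitPotential G conn s v)
      φ-unit : ∀ v → UnitPotential G s v (φ v)
      φ-unit v = proj₂ (unitPotential G conn s v)
      c : Fin (suc n) → ℚ
      c v = 𝟙 (isNonSink s v)

    loadPotential : LoadPotential G s (nonSinkSum s (λ _ → R))
    loadPotential = record
      { h = h
      ; h-sink = trans (sum-cong-≗ (λ v → trans (cong (c v *_) (proj₁ (φ-unit v))) (*-zeroʳ (c v)))) (sum-replicate-zero (suc n))
      ; h-nonNeg = λ w → sum-nonNeg (λ v → *-nonNeg (0≤𝟙 (isNonSink s v)) (unitPotential-nonNeg conn (φ-unit v) w))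
      ; h-≤ = λ w → nonSinkSum-mono-≤ s (λ v v≢s → φ≤R v v≢s w)
      ; laplacian-h = laplacian-h
      }
      where
      h : Fin (suc n) → ℚ
      h w = sum (λ v → c v * φ v w)
      φ≤R : ∀ v → v ≢ s → ∀ w → φ v w ≤ R
      φ≤R v v≢s w = ≤-trans (unitPotential-≤-source conn (φ-unit v) w) (proj₁ R-max v (φ v v) v≢s (φ v , φ-unit v , refl))
      laplacian-h : ∀ u → u ≢ s → laplacian G h u ≡ 1ℚ
      laplacian-h u u≢s = begin
        laplacian G h u                              ≡⟨ laplacian-∑-scaled G c φ u ⟩
        sum (λ v → c v * laplacian G (φ v) u)        ≡⟨ sum-cong-≗ (λ v → cong (c v *_) (proj₂ (φ-unit v) u u≢s)) ⟩
        sum (λ v → c v * 𝟙 (does (u Fin.≟ v)))       ≡⟨ sum-cong-≗ flip-𝟙 ⟩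
        sum (λ v → 𝟙 (does (v Fin.≟ u)) * c v)       ≡⟨ sum-pick u c ⟩
        c u                                          ≡⟨ 𝟙-isNonSink u≢s ⟩
        1ℚ                                           ∎
        where
        open ≡-Reasoning
        flip-𝟙 : ∀ v → c v * 𝟙 (does (u Fin.≟ v)) ≡ 𝟙 (does (v Fin.≟ u)) * c v
        flip-𝟙 v = trans (*-comm (c v) (𝟙 (does (u Fin.≟ v)))) (cong (λ b → 𝟙 b * c v) (does-≟-sym u v))

  -- Greedy firing and the energy

  divFloor*≤ : ∀ a d → divFloor a d ℕ.* d ℕ.≤ a
  divFloor*≤ a zero = ℕ.z≤n
  divFloor*≤ a (suc d) = m/n*n≤m a (suc d)

  ≤suc-divFloor* : ∀ a d → 1 ℕ.≤ d → a ℕ.≤ suc (divFloor a d) ℕ.* d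
  ≤suc-divFloor* a (suc d) _ = subst (ℕ._≤ suc d ℕ.+ a ℕ./ suc d ℕ.* suc d) (sym (m≡m%n+[m/n]*n a (suc d)))
    (ℕ.+-monoˡ-≤ (a ℕ./ suc d ℕ.* suc d) (ℕ.<⇒≤ (m%n<n a (suc d))))

  1≤divFloor : ∀ a d → 1 ℕ.≤ d → d ℕ.≤ a → 1 ℕ.≤ divFloor a d
  1≤divFloor a (suc d) _ d≤a = m≥n⇒m/n>0 d≤a

  fromℕ-totalChips : ∀ {n} (s : Fin n) (σ : Config n) → fromℕ (totalChips s σ) ≡ nonSinkSum s (fromℕ ∘ σ)
  fromℕ-totalChips {n} s σ = begin
    fromℕ (totalChips s σ)                                               ≡⟨ fromℕ-sum nonSinks σ ⟩
    ∑ᴸ nonSinks (fromℕ ∘ σ)                                              ≡⟨ ∑ᴸ-filter (λ v → ¬? (v Fin.≟ s)) (List.allFin n) (fromℕ ∘ σ) ⟩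
    ∑ᴸ (List.allFin n) (λ w → if isNonSink s w then fromℕ (σ w) else 0ℚ) ≡⟨ ∑ᴸ-tabulate id (λ w → if isNonSink s w then fromℕ (σ w) else 0ℚ) ⟩
    sum (λ w → if isNonSink s w then fromℕ (σ w) else 0ℚ)                ≡⟨ sum-cong-≗ (λ w → if-else-0≡𝟙* (isNonSink s w) (fromℕ (σ w))) ⟩
    nonSinkSum s (fromℕ ∘ σ)                                             ∎
    where
    open ≡-Reasoning
    nonSinks : List (Fin n)
    nonSinks = List.filter (λ v → ¬? (v Fin.≟ s)) (List.allFin n)

  module _ {n} (G : Graph n) (s : Fin n) (σ : Config n) (u : Fin n) where

    private
      k : ℕ
      k = quot G σ u
      K : ℚ
      K = fromℕ k

    greedyFire-self : greedyFire G s σ u u ≡ σ u ℕ.∸ k ℕ.* deg G u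
    greedyFire-self with u Fin.≟ u
    ... | yes _ = refl
    ... | no u≢u = ⊥-elim (u≢u refl)

    greedyFire-other : ∀ w → w ≢ u → w ≢ s → greedyFire G s σ u w ≡ (if adj G u w then σ w ℕ.+ k else σ w)
    greedyFire-other w w≢u w≢s with w Fin.≟ u
    ... | yes w≡u = ⊥-elim (w≢u w≡u)
    ... | no _ with w Fin.≟ s
    ...   | yes w≡s = ⊥-elim (w≢s w≡s)
    ...   | no _ with adj G u w
    ...     | true = refl
    ...     | false = refl

    fromℕ-greedyFire : ∀ w → w ≢ s →
      fromℕ (greedyFire G s σ u w) ≡ fromℕ (σ w) + K * 𝟙 (adj G u w) - K * fromℕ (deg G u) * 𝟙 (does (w Fin.≟ u))
    fromℕ-greedyFire w w≢s = ≟-cases w u (λ { refl → self }) other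
      where
      self : fromℕ (greedyFire G s σ u u) ≡ fromℕ (σ u) + K * 𝟙 (adj G u u) - K * fromℕ (deg G u) * 𝟙 (does (u Fin.≟ u))
      self = begin
        fromℕ (greedyFire G s σ u u)                  ≡⟨ cong fromℕ greedyFire-self ⟩
        fromℕ (σ u ℕ.∸ k ℕ.* deg G u)                 ≡⟨ fromℕ-∸ (divFloor*≤ (σ u) (deg G u)) ⟩
        fromℕ (σ u) - fromℕ (k ℕ.* deg G u)           ≡⟨ cong (λ x → fromℕ (σ u) - x) (fromℕ-* k (deg G u)) ⟩
        fromℕ (σ u) - K * fromℕ (deg G u)             ≡⟨ pad (fromℕ (σ u)) K (fromℕ (deg G u)) ⟩
        fromℕ (σ u) + K * 0ℚ - K * fromℕ (deg G u) * 1ℚ ≡⟨ cong₂ (λ a b → fromℕ (σ u) + K * 𝟙 a - K * fromℕ (deg G u) * 𝟙 b)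
                                                           (sym (adj-irrefl G u)) (sym (dec-true (u Fin.≟ u) refl)) ⟩
        fromℕ (σ u) + K * 𝟙 (adj G u u) - K * fromℕ (deg G u) * 𝟙 (does (u Fin.≟ u)) ∎
        where
        open ≡-Reasoning
        pad : ∀ a k d → a - k * d ≡ a + k * 0ℚ - k * d * 1ℚ
        pad = solve 3 (λ a k d → a :- k :* d := a :+ k :* con 0ℚ :- k :* d :* con 1ℚ) refl
      other : w ≢ u → fromℕ (greedyFire G s σ u w) ≡ fromℕ (σ w) + K * 𝟙 (adj G u w) - K * fromℕ (deg G u) * 𝟙 (does (w Fin.≟ u))
      other w≢u = begin
        fromℕ (greedyFire G s σ u w)                        ≡⟨ cong fromℕ (greedyFire-other w w≢u w≢s) ⟩
        fromℕ (if adj G u w then σ w ℕ.+ k else σ w)        ≡⟨ fromℕ-if-+ (adj G u w) (σ w) ⟩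
        fromℕ (σ w) + K * 𝟙 (adj G u w)                     ≡⟨ pad (fromℕ (σ w)) K (𝟙 (adj G u w)) (fromℕ (deg G u)) ⟩
        fromℕ (σ w) + K * 𝟙 (adj G u w) - K * fromℕ (deg G u) * 0ℚ ≡⟨ cong (λ b → fromℕ (σ w) + K * 𝟙 (adj G u w) - K * fromℕ (deg G u) * 𝟙 b)
                                                                      (sym (dec-false (w Fin.≟ u) w≢u)) ⟩
        fromℕ (σ w) + K * 𝟙 (adj G u w) - K * fromℕ (deg G u) * 𝟙 (does (w Fin.≟ u)) ∎
        where
        open ≡-Reasoning
        pad : ∀ a k b d → a + k * b ≡ a + k * b - k * d * 0ℚ
        pad = solve 4 (λ a k b d → a :+ k :* b := a :+ k :* b :- k :* d :* con 0ℚ) refl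
        fromℕ-if-+ : ∀ b a → fromℕ (if b then a ℕ.+ k else a) ≡ fromℕ a + K * 𝟙 b
        fromℕ-if-+ true a = trans (fromℕ-+ a k) (cong (fromℕ a +_) (sym (*-identityʳ K)))
        fromℕ-if-+ false a = sym (trans (cong (fromℕ a +_) (*-zeroʳ K)) (+-identityʳ (fromℕ a)))

  module _ {n} {G : Graph n} {s : Fin n} {H : ℚ} (ψ : LoadPotential G s H) where

    open LoadPotential ψ

    energy : Config n → ℚ
    energy σ = sum (λ w → fromℕ (σ w) * h w)

    energy-nonNeg : ∀ σ → 0ℚ ≤ energy σ
    energy-nonNeg σ = sum-nonNeg (λ w → *-nonNeg (0≤fromℕ (σ w)) (h-nonNeg w))

    h≤𝟙*H : ∀ w → h w ≤ 𝟙 (isNonSink s w) * H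
    h≤𝟙*H w with w Fin.≟ s
    ... | yes refl = ≤-reflexive (trans h-sink (sym (*-zeroˡ H)))
    ... | no _ = subst (h w ≤_) (sym (*-identityˡ H)) (h-≤ w)

    *h-cong-offSink : ∀ {w x y} → (w ≢ s → x ≡ y) → x * h w ≡ y * h w
    *h-cong-offSink {w} {x} {y} x≡y with w Fin.≟ s
    ... | yes refl = trans (cong (x *_) h-sink) (trans (*-zeroʳ x) (sym (trans (cong (y *_) h-sink) (*-zeroʳ y))))
    ... | no w≢s = cong (_* h w) (x≡y w≢s)

    energy-≤-nonSinkSum : ∀ σ → energy σ ≤ nonSinkSum s (fromℕ ∘ σ) * H
    energy-≤-nonSinkSum σ = begin
      energy σ                                          ≤⟨ sum-mono-≤ (λ w → *-monoˡ-≤-0≤ (fromℕ (σ w)) (0≤fromℕ (σ w)) (h≤𝟙*H w)) ⟩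
      sum (λ w → fromℕ (σ w) * (𝟙 (isNonSink s w) * H)) ≡⟨ sum-cong-≗ (λ w → shuffle (fromℕ (σ w)) (𝟙 (isNonSink s w)) H) ⟩
      sum (λ w → 𝟙 (isNonSink s w) * fromℕ (σ w) * H)   ≡⟨ *-distribʳ-sum H (λ w → 𝟙 (isNonSink s w) * fromℕ (σ w)) ⟨
      nonSinkSum s (fromℕ ∘ σ) * H                      ∎
      where
      open ≤-Reasoning
      shuffle : ∀ a c x → a * (c * x) ≡ c * a * x
      shuffle = solve 3 (λ a c x → a :* (c :* x) := c :* a :* x) refl

    0≤H : 0ℚ ≤ H
    0≤H = subst (_≤ H) h-sink (h-≤ s)

    energy-≤-maxQuot : Connected G → ∀ σ k → (∀ w → w ≢ s → quot G σ w ℕ.≤ k) →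
                       energy σ ≤ fromℕ (suc k) * (nonSinkSum s (fromℕ ∘ deg G) * H)
    energy-≤-maxQuot conn σ k quot≤k = ≤-trans (energy-≤-nonSinkSum σ)
      (≤-trans (*-monoʳ-≤-0≤ H 0≤H chips≤) (≤-reflexive (*-assoc (fromℕ (suc k)) (nonSinkSum s (fromℕ ∘ deg G)) H)))
      where
      σ≤ : ∀ w → w ≢ s → fromℕ (σ w) ≤ fromℕ (suc k) * fromℕ (deg G w)
      σ≤ w w≢s = subst (fromℕ (σ w) ≤_) (fromℕ-* (suc k) (deg G w)) (fromℕ-mono-≤ (ℕ.≤-trans
        (≤suc-divFloor* (σ w) (deg G w) (1≤deg G conn w w≢s)) (ℕ.*-monoˡ-≤ (deg G w) (ℕ.s≤s (quot≤k w w≢s)))))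
      chips≤ : nonSinkSum s (fromℕ ∘ σ) ≤ fromℕ (suc k) * nonSinkSum s (fromℕ ∘ deg G)
      chips≤ = ≤-trans (nonSinkSum-mono-≤ s σ≤) (≤-reflexive (nonSinkSum-*ˡ s (fromℕ (suc k)) (fromℕ ∘ deg G)))

    energy-greedyFire : ∀ σ u → u ≢ s → energy (greedyFire G s σ u) ≡ energy σ - fromℕ (quot G σ u)
    energy-greedyFire σ u u≢s = begin
      energy (greedyFire G s σ u)
        ≡⟨ sum-cong-≗ pointwise ⟩
      sum (λ w → fromℕ (σ w) * h w + K * (𝟙 (adj G u w) * h w) - K * d * (𝟙 (does (w Fin.≟ u)) * h w))
        ≡⟨ ∑-distrib-- (λ w → fromℕ (σ w) * h w + K * (𝟙 (adj G u w) * h w)) (λ w → K * d * (𝟙 (does (w Fin.≟ u)) * h w)) ⟩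
      sum (λ w → fromℕ (σ w) * h w + K * (𝟙 (adj G u w) * h w)) - sum (λ w → K * d * (𝟙 (does (w Fin.≟ u)) * h w))
        ≡⟨ cong₂ _-_ (∑-distrib-+ (λ w → fromℕ (σ w) * h w) (λ w → K * (𝟙 (adj G u w) * h w)))
                     (sym (*-distribˡ-sum (K * d) (λ w → 𝟙 (does (w Fin.≟ u)) * h w))) ⟩
      energy σ + sum (λ w → K * (𝟙 (adj G u w) * h w)) - K * d * sum (λ w → 𝟙 (does (w Fin.≟ u)) * h w)
        ≡⟨ cong₂ (λ x y → energy σ + x - K * d * y) (*-distribˡ-sum K (λ w → 𝟙 (adj G u w) * h w)) (sym (sum-pick u h)) ⟨
      energy σ + K * A - K * d * h u
        ≡⟨ solve 5 (λ e k a d x → e :+ k :* a :- k :* d :* x := e :- k :* (d :* x :- a)) refl (energy σ) K A d (h u) ⟩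
      energy σ - K * (d * h u - A)
        ≡⟨ cong (λ x → energy σ - K * x) (trans (sym (laplacian≡deg*-∑ G h u)) (laplacian-h u u≢s)) ⟩
      energy σ - K * 1ℚ
        ≡⟨ cong (λ x → energy σ - x) (*-identityʳ K) ⟩
      energy σ - K ∎
      where
      open ≡-Reasoning
      K : ℚ
      K = fromℕ (quot G σ u)
      d : ℚ
      d = fromℕ (deg G u)
      A : ℚ
      A = sum (λ w → 𝟙 (adj G u w) * h w)
      expand : ∀ a k b d c x → (a + k * b - k * d * c) * x ≡ a * x + k * (b * x) - k * d * (c * x)
      expand = solve 6 (λ a k b d c x → (a :+ k :* b :- k :* d :* c) :* x := a :* x :+ k :* (b :* x) :- k :* d :* (c :* x)) refl
      pointwise : ∀ w → fromℕ (greedyFire G s σ u w) * h w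
                      ≡ fromℕ (σ w) * h w + K * (𝟙 (adj G u w) * h w) - K * d * (𝟙 (does (w Fin.≟ u)) * h w)
      pointwise w = trans (*h-cong-offSink (fromℕ-greedyFire G s σ u w))
        (expand (fromℕ (σ w)) K (𝟙 (adj G u w)) d (𝟙 (does (w Fin.≟ u))) (h w))

  ≤2^⌈log₂⌉ : ∀ x → x ℕ.≤ 2 ^ ⌈log₂ x ⌉
  ≤2^⌈log₂⌉ = <-rec (λ x → x ℕ.≤ 2 ^ ⌈log₂ x ⌉) halving
    where
    halving : ∀ x → (∀ {y} → y ℕ.< x → y ℕ.≤ 2 ^ ⌈log₂ y ⌉) → x ℕ.≤ 2 ^ ⌈log₂ x ⌉
    halving zero _ = z≤n
    halving (suc zero) _ = s≤s z≤n
    halving x@(suc (suc m)) rec = ℕ.≤-trans x≤half+half (ℕ.+-mono-≤ half≤ (ℕ.≤-trans half≤ (ℕ.m≤m+n _ 0)))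
      where
      half : ℕ
      half = ℕ.⌈ x /2⌉
      half≤ : half ℕ.≤ 2 ^ (⌈log₂ x ⌉ ℕ.∸ 1)
      half≤ = subst (λ e → half ℕ.≤ 2 ^ e) (⌈log₂⌈n/2⌉⌉≡⌈log₂n⌉∸1 x) (rec (ℕ.⌈n/2⌉<n m))
      x≤half+half : x ℕ.≤ half ℕ.+ half
      x≤half+half = subst (ℕ._≤ half ℕ.+ half) (ℕ.⌊n/2⌋+⌈n/2⌉≡n x) (ℕ.+-monoˡ-≤ half (ℕ.⌊n/2⌋≤⌈n/2⌉ x))

  -- Abstracts a greedy run: p is the energy, and each step removes its quotient k.
  Descent : ℚ → ℚ → List ℕ → Set
  Descent B p [] = 0ℚ ≤ p
  Descent B p (k ∷ ks) = 1 ℕ.≤ k × p ≤ fromℕ (suc k) * B × Descent B (p - fromℕ k) ks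

  length≤start : ∀ {B p} ks → Descent B p ks → fromℕ (length ks) ≤ p
  length≤start [] 0≤p = 0≤p
  length≤start {p = p} (k ∷ ks) (1≤k , _ , rest) =
    ≤-by-difference ((p - fromℕ k - fromℕ (length ks)) + (fromℕ k - 1ℚ)) difference
      (+-mono-≤ (p≤q⇒0≤q-p (length≤start ks rest)) (p≤q⇒0≤q-p (fromℕ-mono-≤ 1≤k)))
    where
    difference : p - fromℕ (suc (length ks)) ≡ (p - fromℕ k - fromℕ (length ks)) + (fromℕ k - 1ℚ)
    difference = trans (cong (λ x → p - x) (fromℕ-suc (length ks)))
      (solve 3 (λ p k t → p :- (con 1ℚ :+ t) := (p :- k :- t) :+ (k :- con 1ℚ)) refl p (fromℕ k) (fromℕ (length ks)))

  descent-nonNeg : ∀ {B p} ks → Descent B p ks → 0ℚ ≤ p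
  descent-nonNeg ks d = ≤-trans (0≤fromℕ (length ks)) (length≤start ks d)

  descent-scale-pos : ∀ {B p k ks} → Descent B p (k ∷ ks) → 0ℚ < B
  descent-scale-pos {B} {p} {k} {ks} d@(_ , p≤ , _) = *-cancelˡ-<-nonNeg (fromℕ (suc k)) {{nonNegative (0≤fromℕ (suc k))}}
    (subst (_< fromℕ (suc k) * B) (sym (*-zeroʳ (fromℕ (suc k)))) (<-≤-trans 0<p p≤))
    where
    0<p : 0ℚ < p
    0<p = <-≤-trans 0<1 (≤-trans (fromℕ-mono-≤ (s≤s (z≤n {length ks}))) (length≤start (k ∷ ks) d))

  threshold : ℚ → ℕ → ℚ
  threshold B j = fromℕ (2 ^ suc j) * B

  budget : ℚ → ℕ → ℚ
  budget B j = fromℕ (2 ℕ.+ 4 ℕ.* j) * B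

  budget-suc : ∀ B j → fromℕ (2 ^ j) * budget B j + threshold B (suc j) ≡ fromℕ (2 ^ j) * budget B (suc j)
  budget-suc B j = begin
    a * (fromℕ b * B) + fromℕ t * B      ≡⟨ cong (_+ fromℕ t * B) (*-assoc a (fromℕ b) B) ⟨
    a * fromℕ b * B + fromℕ t * B        ≡⟨ *-distribʳ-+ B (a * fromℕ b) (fromℕ t) ⟨
    (a * fromℕ b + fromℕ t) * B          ≡⟨ cong (λ x → (x + fromℕ t) * B) (fromℕ-* (2 ^ j) b) ⟨
    (fromℕ (2 ^ j ℕ.* b) + fromℕ t) * B  ≡⟨ cong (_* B) (fromℕ-+ (2 ^ j ℕ.* b) t) ⟨
    fromℕ (2 ^ j ℕ.* b ℕ.+ t) * B        ≡⟨ cong (λ x → fromℕ x * B) (naturals (2 ^ j) j) ⟩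
    fromℕ (2 ^ j ℕ.* b′) * B             ≡⟨ cong (_* B) (fromℕ-* (2 ^ j) b′) ⟩
    a * fromℕ b′ * B                     ≡⟨ *-assoc a (fromℕ b′) B ⟩
    a * budget B (suc j)                 ∎
    where
    open ≡-Reasoning
    open Data.Nat.Solver.+-*-Solver using () renaming (solve to solveℕ; _:+_ to _⊕_; _:*_ to _⊗_; _:=_ to _⊜_; con to κ)
    a : ℚ
    a = fromℕ (2 ^ j)
    b : ℕ
    b = 2 ℕ.+ 4 ℕ.* j
    b′ : ℕ
    b′ = 2 ℕ.+ 4 ℕ.* suc j
    t : ℕ
    t = 2 ^ suc (suc j)
    naturals : ∀ x j → x ℕ.* (2 ℕ.+ 4 ℕ.* j) ℕ.+ 2 ℕ.* (2 ℕ.* x) ≡ x ℕ.* (2 ℕ.+ 4 ℕ.* suc j)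
    naturals = solveℕ 2 (λ x j → x ⊗ (κ 2 ⊕ κ 4 ⊗ j) ⊕ κ 2 ⊗ (κ 2 ⊗ x) ⊜ x ⊗ (κ 2 ⊕ κ 4 ⊗ (κ 1 ⊕ j))) refl

  module _ {B : ℚ} (0<B : 0ℚ < B) where

    2^j≤quotient : ∀ {j p k} → threshold B j ≤ p → p ≤ fromℕ (suc k) * B → 2 ^ j ℕ.≤ k
    2^j≤quotient {j} {p} {k} X≤p p≤ = ℕ.≤-pred (ℕ.≤-trans (ℕ.+-monoˡ-≤ (2 ^ j) (ℕ.m^n>0 2 j))
      (subst (ℕ._≤ suc k) (cong (2 ^ j ℕ.+_) (ℕ.+-identityʳ (2 ^ j)))
        (fromℕ-cancel-≤ (*-cancelʳ-≤-pos B {{positive 0<B}} (≤-trans X≤p p≤)))))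

    descent-length≤budget : ∀ j {p} ks → Descent B p ks → p < threshold B j → fromℕ (length ks) ≤ budget B j
    descent-length≤budget zero ks d p<X = <⇒≤ (≤-<-trans (length≤start ks d) p<X)
    descent-length≤budget (suc j) {p} ks d p<X = *-cancelˡ-≤-pos a {{positive 0<a}} (≤-trans (phase ks d p<X)
      (≤-trans (+-monoʳ-≤ (a * budget B j) (<⇒≤ p<X)) (≤-reflexive (budget-suc B j))))
      where
      a : ℚ
      a = fromℕ (2 ^ j)
      0<a : 0ℚ < a
      0<a = <-≤-trans 0<1 (fromℕ-mono-≤ (ℕ.m^n>0 2 j))
      -- While p ≥ threshold B j every step removes at least 2 ^ j from p.
      phase : ∀ {p} ks → Descent B p ks → p < threshold B (suc j) → a * fromℕ (length ks) ≤ a * budget B j + p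
      phase {p} [] 0≤p _ = subst (_≤ a * budget B j + p) (sym (*-zeroʳ a))
        (+-mono-≤ (*-nonNeg (<⇒≤ 0<a) (*-nonNeg (0≤fromℕ (2 ℕ.+ 4 ℕ.* j)) (<⇒≤ 0<B))) 0≤p)
      phase {p} (k ∷ ks) d@(_ , p≤ , rest) p<X with p <? threshold B j
      ... | yes p<Xj = ≤-trans (*-monoˡ-≤-0≤ a (<⇒≤ 0<a) (descent-length≤budget j (k ∷ ks) d p<Xj))
                         (subst (_≤ a * budget B j + p) (+-identityʳ (a * budget B j))
                           (+-monoʳ-≤ (a * budget B j) (descent-nonNeg (k ∷ ks) d)))
      ... | no p≮Xj = ≤-by-difference (a * budget B j + (p - fromℕ k) - a * fromℕ (length ks) + (fromℕ k - a)) difference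
            (+-mono-≤ (p≤q⇒0≤q-p (phase ks rest p-k<X)) (p≤q⇒0≤q-p (fromℕ-mono-≤ (2^j≤quotient {j} {p} {k} (≮⇒≥ p≮Xj) p≤))))
        where
        difference : a * budget B j + p - a * fromℕ (suc (length ks))
                     ≡ a * budget B j + (p - fromℕ k) - a * fromℕ (length ks) + (fromℕ k - a)
        difference = trans (cong (λ x → a * budget B j + p - a * x) (fromℕ-suc (length ks)))
          (solve 5 (λ a b p k l → a :* b :+ p :- a :* (con 1ℚ :+ l) := a :* b :+ (p :- k) :- a :* l :+ (k :- a)) refl
            a (budget B j) p (fromℕ k) (fromℕ (length ks)))
        p-k<X : p - fromℕ k < threshold B (suc j)
        p-k<X = ≤-<-trans (≤-by-difference (fromℕ k) (solve 2 (λ p k → p :- (p :- k) := k) refl p (fromℕ k)) (0≤fromℕ k)) p<X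

  -- The handshake lemma

  module _ {n} (G : Graph n) where

    private
      upEdge : Fin n → Fin n → ℚ
      upEdge i j = 𝟙 (adj G i j) * 𝟙 (does (i Fin.<? j))

    fromℕ-numEdges : fromℕ (numEdges G) ≡ sum (λ i → sum (upEdge i))
    fromℕ-numEdges = trans (fromℕ-sum (List.allFin n) upDegree) (trans (∑ᴸ-tabulate id (fromℕ ∘ upDegree)) (sum-cong-≗ row))
      where
      upDegree : Fin n → ℕ
      upDegree i = List.length (List.filter (i Fin.<?_) (neighbours G i))
      row : ∀ i → fromℕ (List.length (List.filter (i Fin.<?_) (neighbours G i))) ≡ sum (upEdge i)
      row i = begin
        fromℕ (List.length (List.filter (i Fin.<?_) (neighbours G i)))
          ≡⟨ fromℕ-length (List.filter (i Fin.<?_) (neighbours G i)) ⟩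
        ∑ᴸ (List.filter (i Fin.<?_) (neighbours G i)) (λ _ → 1ℚ)
          ≡⟨ ∑ᴸ-filter (i Fin.<?_) (neighbours G i) (λ _ → 1ℚ) ⟩
        ∑ᴸ (neighbours G i) (λ j → 𝟙 (does (i Fin.<? j)))
          ≡⟨ ∑ᴸ-filter (λ j → adj G i j Bool.≟ true) (List.allFin n) (λ j → 𝟙 (does (i Fin.<? j))) ⟩
        ∑ᴸ (List.allFin n) (λ j → if does (adj G i j Bool.≟ true) then 𝟙 (does (i Fin.<? j)) else 0ℚ)
          ≡⟨ ∑ᴸ-tabulate id (λ j → if does (adj G i j Bool.≟ true) then 𝟙 (does (i Fin.<? j)) else 0ℚ) ⟩
        sum (λ j → if does (adj G i j Bool.≟ true) then 𝟙 (does (i Fin.<? j)) else 0ℚ)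
          ≡⟨ sum-cong-≗ (λ j → entry (adj G i j) (does (i Fin.<? j))) ⟩
        sum (upEdge i) ∎
        where
        open ≡-Reasoning
        entry : ∀ a b → (if does (a Bool.≟ true) then 𝟙 b else 0ℚ) ≡ 𝟙 a * 𝟙 b
        entry true b = sym (*-identityˡ (𝟙 b))
        entry false b = sym (*-zeroˡ (𝟙 b))

    private
      edge-split : ∀ i j → Tri (i Fin.< j) (i ≡ j) (j Fin.< i) → 𝟙 (adj G i j) ≡ upEdge i j + upEdge j i
      edge-split i j (tri< i<j _ j≮i) rewrite dec-true (i Fin.<? j) i<j | dec-false (j Fin.<? i) j≮i | adj-sym G j i =
        solve 1 (λ a → a := a :* con 1ℚ :+ a :* con 0ℚ) refl (𝟙 (adj G i j))
      edge-split i .i (tri≈ _ refl _) rewrite adj-irrefl G i =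
        sym (trans (cong₂ _+_ (*-zeroˡ (𝟙 (does (i Fin.<? i)))) (*-zeroˡ (𝟙 (does (i Fin.<? i))))) (+-identityʳ 0ℚ))
      edge-split i j (tri> i≮j _ j<i) rewrite dec-false (i Fin.<? j) i≮j | dec-true (j Fin.<? i) j<i | adj-sym G j i =
        solve 1 (λ a → a := a :* con 0ℚ :+ a :* con 1ℚ) refl (𝟙 (adj G i j))

    handshake : sum (λ i → fromℕ (deg G i)) ≡ fromℕ 2 * fromℕ (numEdges G)
    handshake = begin
      sum (λ i → fromℕ (deg G i))                              ≡⟨ sum-cong-≗ (fromℕ-deg G) ⟩
      sum (λ i → sum (λ j → 𝟙 (adj G i j)))                    ≡⟨ sum-cong-≗ (λ i → sum-cong-≗ (λ j → edge-split i j (Fin.<-cmp i j))) ⟩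
      sum (λ i → sum (λ j → upEdge i j + upEdge j i))          ≡⟨ sum-cong-≗ (λ i → ∑-distrib-+ (upEdge i) (λ j → upEdge j i)) ⟩
      sum (λ i → sum (upEdge i) + sum (λ j → upEdge j i))      ≡⟨ ∑-distrib-+ (λ i → sum (upEdge i)) (λ i → sum (λ j → upEdge j i)) ⟩
      M + sum (λ i → sum (λ j → upEdge j i))                   ≡⟨ cong (M +_) (∑-comm (λ i j → upEdge j i)) ⟩
      M + M                                                    ≡⟨ solve 1 (λ m → m :+ m := con (fromℕ 2) :* m) refl M ⟩
      fromℕ 2 * M                                              ≡⟨ cong (fromℕ 2 *_) fromℕ-numEdges ⟨
      fromℕ 2 * fromℕ (numEdges G)                             ∎
      where
      open ≡-Reasoning
      M : ℚ
      M = sum (λ i → sum (upEdge i))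

  ≢⇒1≤n : ∀ {n} {u s : Fin (suc n)} → u ≢ s → 1 ℕ.≤ n
  ≢⇒1≤n {zero} {zero} {zero} u≢s = ⊥-elim (u≢s refl)
  ≢⇒1≤n {suc n} _ = s≤s z≤n

  module _ {n} {G : Graph (suc n)} (conn : Connected G) {s : Fin (suc n)} {R : ℚ} (R-max : IsMaxEffRes G s R) where

    private
      H : ℚ
      H = nonSinkSum s (λ _ → R)
      ψ : LoadPotential G s H
      ψ = loadPotential conn R-max
      D : ℚ
      D = nonSinkSum s (fromℕ ∘ deg G)
      m : ℕ
      m = numEdges G
      0≤R : 0ℚ ≤ R
      0≤R = maxEffRes-nonNeg conn R-max
      0≤D : 0ℚ ≤ D
      0≤D = sum-nonNeg (λ w → *-nonNeg (0≤𝟙 (isNonSink s w)) (0≤fromℕ (deg G w)))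

    quotients : Config (suc n) → List (Fin (suc n)) → List ℕ
    quotients σ [] = []
    quotients σ (u ∷ us) = quot G σ u ∷ quotients (greedyFire G s σ u) us

    length-quotients : ∀ σ us → length (quotients σ us) ≡ length us
    length-quotients σ [] = refl
    length-quotients σ (u ∷ us) = cong suc (length-quotients (greedyFire G s σ u) us)

    greedyRun⇒descent : ∀ σ us → GreedyRun G s σ us → Descent (D * H) (energy ψ σ) (quotients σ us)
    greedyRun⇒descent σ [] _ = energy-nonNeg ψ σ
    greedyRun⇒descent σ (u ∷ us) ((u≢s , full , maximal) , run) =
      1≤divFloor (σ u) (deg G u) (1≤deg G conn u u≢s) full ,
      energy-≤-maxQuot ψ conn σ (quot G σ u) maximal ,
      subst (λ p → Descent (D * H) p (quotients (greedyFire G s σ u) us)) (energy-greedyFire ψ σ u u≢s)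
        (greedyRun⇒descent (greedyFire G s σ u) us run)

    D≤2m : D ≤ fromℕ (2 ℕ.* m)
    D≤2m = subst (D ≤_) (trans (handshake G) (sym (fromℕ-* 2 m))) (nonSinkSum-≤-sum s (0≤fromℕ ∘ deg G))

    D*H≤ : D * H ≤ fromℕ (2 ℕ.* m ℕ.* (2 ℕ.* m)) * R
    D*H≤ = begin
      D * H                                   ≤⟨ *-monoˡ-≤-0≤ D 0≤D H≤R*D ⟩
      D * (R * D)                             ≤⟨ *-monoʳ-≤-0≤ (R * D) (*-nonNeg 0≤R 0≤D) D≤2m ⟩
      fromℕ (2 ℕ.* m) * (R * D)               ≤⟨ *-monoˡ-≤-0≤ (fromℕ (2 ℕ.* m)) (0≤fromℕ (2 ℕ.* m)) (*-monoˡ-≤-0≤ R 0≤R D≤2m) ⟩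
      fromℕ (2 ℕ.* m) * (R * fromℕ (2 ℕ.* m)) ≡⟨ rearrange (fromℕ (2 ℕ.* m)) R ⟩
      fromℕ (2 ℕ.* m) * fromℕ (2 ℕ.* m) * R   ≡⟨ cong (_* R) (fromℕ-* (2 ℕ.* m) (2 ℕ.* m)) ⟨
      fromℕ (2 ℕ.* m ℕ.* (2 ℕ.* m)) * R       ∎
      where
      open ≤-Reasoning
      rearrange : ∀ x r → x * (r * x) ≡ x * x * r
      rearrange = solve 2 (λ x r → x :* (r :* x) := x :* x :* r) refl
      H≤R*D : H ≤ R * D
      H≤R*D = ≤-trans (nonSinkSum-mono-≤ s (λ w w≢s → subst (_≤ R * fromℕ (deg G w)) (*-identityʳ R)
                         (*-monoˡ-≤-0≤ R 0≤R (fromℕ-mono-≤ (1≤deg G conn w w≢s)))))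
                      (≤-reflexive (nonSinkSum-*ˡ s R (fromℕ ∘ deg G)))

    budget≤ : ∀ {L} → 1 ℕ.≤ L → 0ℚ < D * H → budget (D * H) L ≤ fromℕ 24 * R * fromℕ (m ^ 2 ℕ.* L)
    budget≤ {L} 1≤L 0<B = begin
      fromℕ (2 ℕ.+ 4 ℕ.* L) * (D * H)                        ≤⟨ *-monoʳ-≤-0≤ (D * H) (<⇒≤ 0<B) (fromℕ-mono-≤ 2+4L≤6L) ⟩
      fromℕ (6 ℕ.* L) * (D * H)                              ≤⟨ *-monoˡ-≤-0≤ (fromℕ (6 ℕ.* L)) (0≤fromℕ (6 ℕ.* L)) D*H≤ ⟩
      fromℕ (6 ℕ.* L) * (fromℕ (2 ℕ.* m ℕ.* (2 ℕ.* m)) * R)  ≡⟨ *-assoc (fromℕ (6 ℕ.* L)) _ R ⟨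
      fromℕ (6 ℕ.* L) * fromℕ (2 ℕ.* m ℕ.* (2 ℕ.* m)) * R    ≡⟨ cong (_* R) (fromℕ-* (6 ℕ.* L) (2 ℕ.* m ℕ.* (2 ℕ.* m))) ⟨
      fromℕ (6 ℕ.* L ℕ.* (2 ℕ.* m ℕ.* (2 ℕ.* m))) * R        ≡⟨ cong (λ x → fromℕ x * R) (naturals L m) ⟩
      fromℕ (24 ℕ.* (m ^ 2 ℕ.* L)) * R                       ≡⟨ cong (_* R) (fromℕ-* 24 (m ^ 2 ℕ.* L)) ⟩
      fromℕ 24 * fromℕ (m ^ 2 ℕ.* L) * R                     ≡⟨ swap (fromℕ 24) (fromℕ (m ^ 2 ℕ.* L)) R ⟩
      fromℕ 24 * R * fromℕ (m ^ 2 ℕ.* L)                     ∎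
      where
      open ≤-Reasoning
      open Data.Nat.Solver.+-*-Solver using () renaming (solve to solveℕ; _:+_ to _⊕_; _:*_ to _⊗_; _:=_ to _⊜_; con to κ)
      2+4L≤6L : 2 ℕ.+ 4 ℕ.* L ℕ.≤ 6 ℕ.* L
      2+4L≤6L = subst (2 ℕ.+ 4 ℕ.* L ℕ.≤_) (sym (ℕ.*-distribʳ-+ L 2 4)) (ℕ.+-monoˡ-≤ (4 ℕ.* L) (ℕ.*-monoʳ-≤ 2 1≤L))
      naturals : ∀ l m → 6 ℕ.* l ℕ.* (2 ℕ.* m ℕ.* (2 ℕ.* m)) ≡ 24 ℕ.* (m ^ 2 ℕ.* l)
      naturals = solveℕ 2 (λ l m → κ 6 ⊗ l ⊗ (κ 2 ⊗ m ⊗ (κ 2 ⊗ m)) ⊜ κ 24 ⊗ (m ⊗ (m ⊗ κ 1) ⊗ l)) refl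
      swap : ∀ a b r → a * b * r ≡ a * r * b
      swap = solve 3 (λ a b r → a :* b :* r := a :* r :* b) refl

    module _ (σ : Config (suc n)) {u : Fin (suc n)} (u≢s : u ≢ s) (full : deg G u ℕ.≤ σ u) where

      private
        1≤deg-u : 1ℚ ≤ fromℕ (deg G u)
        1≤deg-u = fromℕ-mono-≤ (1≤deg G conn u u≢s)

      1≤totalChips : 1 ℕ.≤ totalChips s σ
      1≤totalChips = fromℕ-cancel-≤ (≤-trans 1≤deg-u (≤-trans (fromℕ-mono-≤ full)
        (subst (fromℕ (σ u) ≤_) (sym (fromℕ-totalChips s σ)) (≤-nonSinkSum s (0≤fromℕ ∘ σ) u≢s))))

      1≤⌈log₂nN⌉ : 1 ℕ.≤ ⌈log₂ (suc n ℕ.* totalChips s σ) ⌉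
      1≤⌈log₂nN⌉ = ⌈log₂⌉-mono-≤ {2} (ℕ.*-mono-≤ (s≤s (≢⇒1≤n u≢s)) 1≤totalChips)

      energy<threshold : (0<B : 0ℚ < D * H) → energy ψ σ < threshold (D * H) ⌈log₂ (suc n ℕ.* totalChips s σ) ⌉
      energy<threshold 0<B = begin-strict
        energy ψ σ                   ≤⟨ energy-≤-nonSinkSum ψ σ ⟩
        nonSinkSum s (fromℕ ∘ σ) * H ≡⟨ cong (_* H) (fromℕ-totalChips s σ) ⟨
        fromℕ N * H                  ≤⟨ *-monoˡ-≤-0≤ (fromℕ N) (0≤fromℕ N) H≤D*H ⟩
        fromℕ N * (D * H)            <⟨ *-monoˡ-<-pos (D * H) {{positive 0<B}} (fromℕ-mono-< N<2^[1+L]) ⟩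
        fromℕ (2 ^ suc L) * (D * H)  ∎
        where
        open ≤-Reasoning
        N : ℕ
        N = totalChips s σ
        L : ℕ
        L = ⌈log₂ (suc n ℕ.* N) ⌉
        H≤D*H : H ≤ D * H
        H≤D*H = subst (_≤ D * H) (*-identityˡ H)
          (*-monoʳ-≤-0≤ H (0≤H ψ) (≤-trans 1≤deg-u (≤-nonSinkSum s (0≤fromℕ ∘ deg G) u≢s)))
        N<2^[1+L] : N ℕ.< 2 ^ suc L
        N<2^[1+L] = ℕ.≤-<-trans (ℕ.≤-trans (ℕ.m≤n*m N (suc n)) (≤2^⌈log₂⌉ (suc n ℕ.* N)))
                      (ℕ.^-monoʳ-< 2 (s≤s (s≤s z≤n)) (ℕ.n<1+n L))

    greedyRun-length≤ : ∀ σ us → GreedyRun G s σ us →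
                        fromℕ (length us) ≤ fromℕ 24 * R * fromℕ (m ^ 2 ℕ.* ⌈log₂ (suc n ℕ.* totalChips s σ) ⌉)
    greedyRun-length≤ σ [] _ = *-nonNeg (*-nonNeg (0≤fromℕ 24) 0≤R) (0≤fromℕ (m ^ 2 ℕ.* ⌈log₂ (suc n ℕ.* totalChips s σ) ⌉))
    greedyRun-length≤ σ us@(u ∷ _) run@((u≢s , full , _) , _) = begin
      fromℕ (length us)                ≡⟨ cong fromℕ (length-quotients σ us) ⟨
      fromℕ (length (quotients σ us))  ≤⟨ descent-length≤budget 0<B L (quotients σ us) descent (energy<threshold σ u≢s full 0<B) ⟩
      budget (D * H) L                 ≤⟨ budget≤ (1≤⌈log₂nN⌉ σ u≢s full) 0<B ⟩
      fromℕ 24 * R * fromℕ (m ^ 2 ℕ.* L) ∎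
      where
      open ≤-Reasoning
      L : ℕ
      L = ⌈log₂ (suc n ℕ.* totalChips s σ) ⌉
      descent : Descent (D * H) (energy ψ σ) (quotients σ us)
      descent = greedyRun⇒descent σ us run
      0<B : 0ℚ < D * H
      0<B = descent-scale-pos descent

open import Defs
open import Data.Nat using (ℕ; zero; suc; _*_; _^_)
open import Data.Nat.Logarithm using (⌈log₂_⌉)
open import Data.Fin using (Fin)
open import Data.List using (List; length)
open import Data.Rational using (ℚ; _≤_) renaming (_*_ to _*ℚ_)
open import Data.Product using (Σ; _,_)
open GreedyFiring using (greedyRun-length≤)

theorem1p4 : Σ ℕ λ C →
    ∀ (n : ℕ) (G : Graph n) (s : Fin n) → Connected G →
    (σ : Config n) (R : ℚ) → IsMaxEffRes G s R →
    (us : List (Fin n)) → GreedyRun G s σ us →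
    fromℕ (length us) ≤
      (fromℕ C *ℚ R) *ℚ fromℕ (numEdges G ^ 2 * ⌈log₂ (n * totalChips s σ) ⌉)
theorem1p4 = 24 , λ where
  zero _ ()
  (suc n) G s conn σ R R-max us run → greedyRun-length≤ conn R-max σ us run
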